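{- Let $X\subseteq\mathrm{PVAR}$ be finite, $\alpha\in\mathbb{N}$, and let $\varphi$ be a Boolean combination of formulae from $\mathrm{Core}(X,\alpha)$. Then there is a disjunction $\psi=\psi_1\vee\dots\vee\psi_n$ with $\psi_i\in\mathrm{Type}(X,\max(|X|,\alpha))$ for all $i$ such that $\vdash_{\mathsf{C}}\varphi\Leftrightarrow\psi$.
   Context: Syntax of $\mathrm{SL}(\ast,\mathrel{ -\!\!\ast})$: fix a countably infinite set $\mathrm{PVAR}$ of program variables. Formulae: $\varphi ::= x = y \mid x \hookrightarrow y \mid \mathrm{emp} \mid \neg\varphi \mid \varphi\wedge\varphi \mid \varphi \ast \varphi \mid \varphi \mathrel{ -\!\!\ast} \varphi$ ($x,y\in\mathrm{PVAR}$). Abbreviations: $\bot:=\neg(x=x)$, $\top:=\neg\bot$, $\mathrm{alloc}(x):=(x\hookrightarrow x)\mathrel{ -\!\!\ast}\bot$, $\mathrm{size}\ge0:=\top$, $\mathrm{size}\ge1:=\neg\mathrm{emp}$, $\mathrm{size}\ge\beta:=\neg\mathrm{emp}\ast\mathrm{size}\ge\beta-1$ for $\beta\ge2$. Core formulae: for finite $X\subseteq\mathrm{PVAR}$ and $\alpha\in\mathbb{N}$, $\mathrm{Core}(X,\alpha)=\{x=y,\ \mathrm{alloc}(x),\ x\hookrightarrow y,\ \mathrm{size}\ge\beta : x,y\in X,\ \beta\in[0,\alpha]\}$. A literal is a core formula or its negation. A core type in $\mathrm{Type}(X,\alpha)$ is a conjunction of literals over $\mathrm{Core}(X,\alpha)$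 such that for every $\psi\in\mathrm{Core}(X,\alpha)$, exactly one of $\psi$, $\neg\psi$ occurs as a conjunct (and not both). The proof system $\mathsf{C}$ (derivability is the least set of formulae containing all instances of the axiom schemata and closed under the rules) consists of all axiom schemata of classical propositional calculus, modus ponens, and: (1) $x=x$; (2) $\varphi\wedge x=y\Rightarrow\varphi'$, where $\varphi'$ is obtained from $\varphi$ by replacing every occurrence of $y$ with $x$; (3) $x\hookrightarrow y\Rightarrow\mathrm{alloc}(x)$; (4) $(x\hookrightarrow y\wedge x\hookrightarrow z)\Rightarrow y=z$; (5) $\mathrm{size}\ge\beta+1\Rightarrow\mathrm{size}\ge\beta$ for $\beta\in\mathbb{N}$; (6) $\bigwedge_{x\in X}(\mathrm{alloc}(x)\wedge\bigwedge_{y\in X\setminus\{x\}}\neg(x=y))\Rightarrow\mathrm{size}\ge|X|$ for finite $X\subseteq\mathrm{PVAR}$. -}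

module Defs where

open import Data.Nat using (ℕ; zero; suc; _≤_; _≟_)
open import Data.Bool using (Bool; true; false; not; _∧_)
open import Data.List using (List; []; _∷_; _++_; [_])
open import Data.List.Membership.Propositional using (_∈_)
open import Data.List.Relation.Unary.All using (All)
open import Data.Product using (_×_)
open import Data.Sum using (_⊎_)
open import Relation.Nullary using (¬_; yes; no)
open import Relation.Binary.PropositionalEquality using (_≡_)

PVar : Set
PVar = ℕ

data Form : Set where
  eqF  : PVar → PVar → Form
  ptF  : PVar → PVar → Form
  emp  : Form
  neg  : Form → Form
  andF : Form → Form → Form
  star : Form → Form → Form
  wand : Form → Form → Form

botF : Form
botF = neg (eqF 0 0)

topF : Form
topF = neg botF

orF : Form → Form → Form
orF φ ψ = neg (andF (neg φ) (neg ψ))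

impF : Form → Form → Form
impF φ ψ = neg (andF φ (neg ψ))

iffF : Form → Form → Form
iffF φ ψ = andF (impF φ ψ) (impF ψ φ)

alloc : PVar → Form
alloc x = wand (ptF x x) botF

sizeGe : ℕ → Form
sizeGe zero = topF
sizeGe (suc zero) = neg emp
sizeGe (suc (suc β)) = star (neg emp) (sizeGe (suc β))

bigAnd : List Form → Form
bigAnd [] = topF
bigAnd (φ ∷ []) = φ
bigAnd (φ ∷ ψ ∷ φs) = andF φ (bigAnd (ψ ∷ φs))

bigOr : List Form → Form
bigOr [] = botF
bigOr (φ ∷ []) = φ
bigOr (φ ∷ ψ ∷ φs) = orF φ (bigOr (ψ ∷ φs))

-- Classical propositional calculus: a formula is an instance of a propositional
-- tautology iff it is true under every Boolean valuation of its maximal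
-- non-Boolean subformulae (everything other than ¬ and ∧ is treated as an atom).
evalP : (Form → Bool) → Form → Bool
evalP v (neg φ) = not (evalP v φ)
evalP v (andF φ ψ) = evalP v φ ∧ evalP v ψ
evalP v φ = v φ

Taut : Form → Set
Taut φ = (v : Form → Bool) → evalP v φ ≡ true

renV : PVar → PVar → PVar → PVar
renV y x z with z ≟ y
... | yes _ = x
... | no _ = z

ren : PVar → PVar → Form → Form
ren y x (eqF a b) = eqF (renV y x a) (renV y x b)
ren y x (ptF a b) = ptF (renV y x a) (renV y x b)
ren y x emp = emp
ren y x (neg φ) = neg (ren y x φ)
ren y x (andF φ ψ) = andF (ren y x φ) (ren y x ψ)
ren y x (star φ ψ) = star (ren y x φ) (ren y x ψ)
ren y x (wand φ ψ) = wand (ren y x φ) (ren y x ψ)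

-- Finite sets of variables are duplicate-free lists.
data Distinct : List PVar → Set where
  []  : Distinct []
  _∷_ : ∀ {x xs} → ¬ (x ∈ xs) → Distinct xs → Distinct (x ∷ xs)

card : List PVar → ℕ
card [] = 0
card (_ ∷ xs) = suc (card xs)

-- Premise of axiom (6): ⋀_{x∈X} (alloc(x) ∧ ⋀_{y∈X∖{x}} ¬(x = y))
neqOthers : PVar → List PVar → List Form
neqOthers x [] = []
neqOthers x (y ∷ ys) with y ≟ x
... | yes _ = neqOthers x ys
... | no _ = neg (eqF x y) ∷ neqOthers x ys

ax6Prem : List PVar → List PVar → List Form
ax6Prem X [] = []
ax6Prem X (x ∷ xs) = andF (alloc x) (bigAnd (neqOthers x X)) ∷ ax6Prem X xs

data ⊢C_ : Form → Set where
  taut  : ∀ {φ} → Taut φ → ⊢C φ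
  mp    : ∀ {φ ψ} → ⊢C φ → ⊢C impF φ ψ → ⊢C ψ
  ax1   : ∀ x → ⊢C eqF x x
  ax2   : ∀ φ x y → ⊢C impF (andF φ (eqF x y)) (ren y x φ)
  ax3   : ∀ x y → ⊢C impF (ptF x y) (alloc x)
  ax4   : ∀ x y z → ⊢C impF (andF (ptF x y) (ptF x z)) (eqF y z)
  ax5   : ∀ β → ⊢C impF (sizeGe (suc β)) (sizeGe β)
  ax6   : ∀ X → Distinct X → ⊢C impF (bigAnd (ax6Prem X X)) (sizeGe (card X))

data IsCore (X : List PVar) (α : ℕ) : Form → Set where
  cEq    : ∀ {x y} → x ∈ X → y ∈ X → IsCore X α (eqF x y)
  cAlloc : ∀ {x} → x ∈ X → IsCore X α (alloc x)
  cPt    : ∀ {x y} → x ∈ X → y ∈ X → IsCore X α (ptF x y)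
  cSize  : ∀ {β} → β ≤ α → IsCore X α (sizeGe β)

data IsLiteral (X : List PVar) (α : ℕ) : Form → Set where
  pos : ∀ {ψ} → IsCore X α ψ → IsLiteral X α ψ
  ngt : ∀ {ψ} → IsCore X α ψ → IsLiteral X α (neg ψ)

data IsBoolComb (X : List PVar) (α : ℕ) : Form → Set where
  bcCore : ∀ {ψ} → IsCore X α ψ → IsBoolComb X α ψ
  bcNeg  : ∀ {φ} → IsBoolComb X α φ → IsBoolComb X α (neg φ)
  bcAnd  : ∀ {φ ψ} → IsBoolComb X α φ → IsBoolComb X α ψ → IsBoolComb X α (andF φ ψ)

conjuncts : Form → List Form
conjuncts (andF φ ψ) = conjuncts φ ++ conjuncts ψ
conjuncts φ = [ φ ]

IsType : List PVar → ℕ → Form → Set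
IsType X α φ =
  All (IsLiteral X α) (conjuncts φ) ×
  ((ψ : Form) → IsCore X α ψ →
     ((ψ ∈ conjuncts φ) × ¬ (neg ψ ∈ conjuncts φ)) ⊎
     ((neg ψ ∈ conjuncts φ) × ¬ (ψ ∈ conjuncts φ)))

module Submission where

-- Proof by the truth-table (full disjunctive normal form) construction.  Core(X, m)
-- is enumerated as a repetition-free list C (X is duplicate-free).  A sign
-- pattern chooses c or ¬c for each entry c of C; the conjunction of these
-- literals is a core type, since no core formula is the negation of another and
-- C has no repetitions.  Core(X, α) ⊆ Core(X, m), so a sign pattern determines
-- the value of φ; the disjunction of the conjunctions of the patterns making φ
-- true agrees with φ under every valuation in which the atom 0 = 0 holds, because
-- exactly the pattern read off from the valuation has a true conjunction.  Such
-- agreement gives a C-proof via the tautology axioms, axiom (1) and modus ponens.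

open import Defs
open import Data.Nat using (ℕ; zero; suc; _⊔_; _≤_; z≤n; s≤s; s≤s⁻¹)
open import Data.Nat.Properties using (≤-trans; m≤n⊔m)
open import Data.Bool using (Bool; true; false; not; _∧_; _∨_; T; T?)
open import Data.Bool.Properties using (∧-identityʳ; ∨-identityʳ; not-involutive; T-≡; T-not-≡; ⇔→≡)
open import Data.Bool.ListAction using (all; any)
open import Data.List using (List; []; _∷_; [_]; _++_; map; concat; upTo; cartesianProduct; cartesianProductWith; filter)
open import Data.List.Membership.Propositional using (_∈_; find; lose)
open import Data.List.Membership.Propositional.Properties
  using (∈-map⁺; ∈-map⁻; ∈-concat⁺; ∈-upTo⁺; ∈-upTo⁻; ∈-cartesianProduct⁺; ∈-cartesianProduct⁻; ∈-cartesianProductWith⁺; ∈-filter⁺; ∈-filter⁻)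
open import Data.List.Membership.Propositional.Properties.WithK using (unique⇒irrelevant)
open import Data.List.Relation.Unary.Any using (Any; here; there)
import Data.List.Relation.Unary.Any.Properties as Any
open import Data.List.Relation.Unary.All using (All; []; _∷_; lookup; tabulate)
import Data.List.Relation.Unary.All.Properties as All
open import Data.List.Relation.Unary.AllPairs using ([]; _∷_)
open import Data.List.Relation.Unary.Unique.Propositional using (Unique)
import Data.List.Relation.Unary.Unique.Propositional.Properties as Unique
open import Data.List.Relation.Binary.Disjoint.Propositional using (Disjoint)
open import Data.Product using (Σ; ∃; _×_; _,_; proj₂; uncurry)
open import Data.Sum using (_⊎_; inj₁; inj₂)
open import Data.Empty using (⊥-elim)
open import Function using (_∘_; _⇔_; mk⇔; Equivalence; case_of_)
open import Function.Properties.Equivalence using () renaming (trans to ⇔-trans)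
open import Relation.Nullary using (¬_)
open import Relation.Binary.PropositionalEquality using (_≡_; _≢_; refl; sym; cong; cong₂; subst)

open Equivalence using (to; from)

-- A valuation is standard when the atom 0 = 0, used to define ⊤ and ⊥, is
-- true; under such valuations ⊤ and ⊥ receive their intended values.
Standard : (Form → Bool) → Set
Standard v = v (eqF 0 0) ≡ true

-- De Morgan's law in the form produced by the encoding of ∨.
not-∧-not : ∀ a b → not (not a ∧ not b) ≡ a ∨ b
not-∧-not true b = refl
not-∧-not false b = not-involutive b

T-ext : ∀ {a b} → (T a → T b) → (T b → T a) → a ≡ b
T-ext f g = ⇔→≡ (mk⇔ (to T-≡ ∘ f ∘ from T-≡) (to T-≡ ∘ g ∘ from T-≡))

module _ {v : Form → Bool} (std : Standard v) where

  evalP-bigAnd : ∀ L → evalP v (bigAnd L) ≡ all (evalP v) L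
  evalP-bigAnd [] rewrite std = refl
  evalP-bigAnd (φ ∷ []) = sym (∧-identityʳ (evalP v φ))
  evalP-bigAnd (φ ∷ ψ ∷ L) = cong (evalP v φ ∧_) (evalP-bigAnd (ψ ∷ L))

  evalP-bigOr : ∀ L → evalP v (bigOr L) ≡ any (evalP v) L
  evalP-bigOr [] rewrite std = refl
  evalP-bigOr (φ ∷ []) = sym (∨-identityʳ (evalP v φ))
  evalP-bigOr (φ ∷ ψ ∷ L) rewrite evalP-bigOr (ψ ∷ L) =
    not-∧-not (evalP v φ) (any (evalP v) (ψ ∷ L))

  bigAnd-holds : ∀ L → T (evalP v (bigAnd L)) ⇔ All (T ∘ evalP v) L
  bigAnd-holds L = subst (λ b → T b ⇔ All (T ∘ evalP v) L) (sym (evalP-bigAnd L))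
    (mk⇔ (All.all⁺ (evalP v) L) (All.all⁻ (evalP v)))

  bigOr-holds : ∀ L → T (evalP v (bigOr L)) ⇔ Any (T ∘ evalP v) L
  bigOr-holds L = subst (λ b → T b ⇔ Any (T ∘ evalP v) L) (sym (evalP-bigOr L))
    (mk⇔ (Any.any⁻ (evalP v) L) (Any.any⁺ (evalP v)))

-- Formulae with the same truth value under every standard valuation are
-- C-provably equivalent: 0 = 0 → (φ ⇔ ψ) is a tautology, and 0 = 0 is axiom (1).
truth-table : ∀ {φ ψ} → (∀ v → Standard v → evalP v φ ≡ evalP v ψ) → ⊢C iffF φ ψ
truth-table {φ} {ψ} agree = mp (ax1 0) (taut tautology)
  where
  iff-refl : ∀ b → not (not (not (b ∧ not b) ∧ not (b ∧ not b))) ≡ true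
  iff-refl true = refl
  iff-refl false = refl
  tautology : Taut (impF (eqF 0 0) (iffF φ ψ))
  tautology v with v (eqF 0 0) in std
  ... | false = refl
  ... | true rewrite agree v std = iff-refl (evalP v ψ)

module _ {X : List PVar} {α : ℕ} where

  evalBC : ∀ {φ} → (∀ {ψ} → IsCore X α ψ → Bool) → IsBoolComb X α φ → Bool
  evalBC ρ (bcCore c) = ρ c
  evalBC ρ (bcNeg d) = not (evalBC ρ d)
  evalBC ρ (bcAnd d e) = evalBC ρ d ∧ evalBC ρ e

  evalBC-sound : ∀ {φ} (ρ : ∀ {ψ} → IsCore X α ψ → Bool) (v : Form → Bool) →
                 (∀ {ψ} (c : IsCore X α ψ) → ρ c ≡ evalP v ψ) →
                 (d : IsBoolComb X α φ) → evalBC ρ d ≡ evalP v φ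
  evalBC-sound ρ v ρ≡v (bcCore c) = ρ≡v c
  evalBC-sound ρ v ρ≡v (bcNeg d) = cong not (evalBC-sound ρ v ρ≡v d)
  evalBC-sound ρ v ρ≡v (bcAnd d e) =
    cong₂ _∧_ (evalBC-sound ρ v ρ≡v d) (evalBC-sound ρ v ρ≡v e)

core-mono : ∀ {X α m ψ} → α ≤ m → IsCore X α ψ → IsCore X m ψ
core-mono α≤m (cEq x∈ y∈) = cEq x∈ y∈
core-mono α≤m (cAlloc x∈) = cAlloc x∈
core-mono α≤m (cPt x∈ y∈) = cPt x∈ y∈
core-mono α≤m (cSize β≤α) = cSize (≤-trans β≤α α≤m)

module _ {X : List PVar} {m : ℕ} where

  core≢⊥ : ∀ {φ} → IsCore X m φ → φ ≢ botF
  core≢⊥ (cSize {zero} _) ()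
  core≢⊥ (cSize {suc zero} _) ()
  core≢⊥ (cSize {suc (suc _)} _) ()

  core≢emp : ∀ {φ} → IsCore X m φ → φ ≢ emp
  core≢emp (cSize {zero} _) ()
  core≢emp (cSize {suc zero} _) ()
  core≢emp (cSize {suc (suc _)} _) ()

  -- No core formula is the negation of a core formula: the only negated core
  -- formulae are size≥0 = ¬⊥ and size≥1 = ¬emp.  Hence ψ and ¬ψ never collide.
  core≢neg-core : ∀ {φ ψ} → IsCore X m φ → IsCore X m ψ → φ ≢ neg ψ
  core≢neg-core (cSize {zero} _) c refl = core≢⊥ c refl
  core≢neg-core (cSize {suc zero} _) c refl = core≢emp c refl
  core≢neg-core (cSize {suc (suc _)} _) _ ()

  core-conjuncts : ∀ {φ} → IsCore X m φ → conjuncts φ ≡ [ φ ]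
  core-conjuncts (cEq _ _) = refl
  core-conjuncts (cAlloc _) = refl
  core-conjuncts (cPt _ _) = refl
  core-conjuncts (cSize {zero} _) = refl
  core-conjuncts (cSize {suc zero} _) = refl
  core-conjuncts (cSize {suc (suc _)} _) = refl

-- The formulae size≥β are pairwise distinct and differ from all atoms and
-- allocation formulae; this makes the enumeration of Core(X, m) repetition-free.
sizeGe-injective : ∀ {β γ} → sizeGe β ≡ sizeGe γ → β ≡ γ
sizeGe-injective {zero} {zero} _ = refl
sizeGe-injective {zero} {suc zero} ()
sizeGe-injective {zero} {suc (suc _)} ()
sizeGe-injective {suc zero} {zero} ()
sizeGe-injective {suc zero} {suc zero} _ = refl
sizeGe-injective {suc zero} {suc (suc _)} ()
sizeGe-injective {suc (suc _)} {zero} ()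
sizeGe-injective {suc (suc _)} {suc zero} ()
sizeGe-injective {suc (suc β)} {suc (suc γ)} e = cong suc (sizeGe-injective (star-injectiveʳ e))
  where
  star-injectiveʳ : ∀ {φ ψ φ′ ψ′} → star φ ψ ≡ star φ′ ψ′ → ψ ≡ ψ′
  star-injectiveʳ refl = refl

sizeGe≢alloc : ∀ β x → sizeGe β ≢ alloc x
sizeGe≢alloc zero _ ()
sizeGe≢alloc (suc zero) _ ()
sizeGe≢alloc (suc (suc _)) _ ()

sizeGe≢eqF : ∀ β x y → sizeGe β ≢ eqF x y
sizeGe≢eqF zero _ _ ()
sizeGe≢eqF (suc zero) _ _ ()
sizeGe≢eqF (suc (suc _)) _ _ ()

sizeGe≢ptF : ∀ β x y → sizeGe β ≢ ptF x y
sizeGe≢ptF zero _ _ ()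
sizeGe≢ptF (suc zero) _ _ ()
sizeGe≢ptF (suc (suc _)) _ _ ()

images-disjoint : ∀ {A B : Set} {f : A → Form} {g : B → Form} {xs ys} →
                  (∀ a b → f a ≢ g b) → Disjoint (map f xs) (map g ys)
images-disjoint f≢g (p , q) with ∈-map⁻ _ p | ∈-map⁻ _ q
... | a , _ , refl | b , _ , fa≡gb = f≢g a b fa≡gb

distinct⇒unique : ∀ {xs} → Distinct xs → Unique xs
distinct⇒unique [] = []
distinct⇒unique {x ∷ xs} (x∉xs ∷ d) = All.¬Any⇒All¬ xs x∉xs ∷ distinct⇒unique d

coreBlocks : List PVar → ℕ → List (List Form)
coreBlocks X m =
  map sizeGe (upTo (suc m)) ∷ map alloc X ∷
  map (uncurry eqF) (cartesianProduct X X) ∷ map (uncurry ptF) (cartesianProduct X X) ∷ []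

coreList : List PVar → ℕ → List Form
coreList X m = concat (coreBlocks X m)

module _ (X : List PVar) (m : ℕ) where

  coreList-complete : ∀ {ψ} → IsCore X m ψ → ψ ∈ coreList X m
  coreList-complete (cSize β≤m) =
    ∈-concat⁺ {xss = coreBlocks X m} (here (∈-map⁺ sizeGe (∈-upTo⁺ (s≤s β≤m))))
  coreList-complete (cAlloc x∈X) =
    ∈-concat⁺ {xss = coreBlocks X m} (there (here (∈-map⁺ alloc x∈X)))
  coreList-complete (cEq x∈X y∈X) =
    ∈-concat⁺ {xss = coreBlocks X m}
      (there (there (here (∈-map⁺ (uncurry eqF) (∈-cartesianProduct⁺ x∈X y∈X)))))
  coreList-complete (cPt x∈X y∈X) =
    ∈-concat⁺ {xss = coreBlocks X m}
      (there (there (there (here (∈-map⁺ (uncurry ptF) (∈-cartesianProduct⁺ x∈X y∈X))))))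

  coreList-sound : All (IsCore X m) (coreList X m)
  coreList-sound = All.concat⁺
    ( block sizeGe (λ β∈ → cSize (s≤s⁻¹ (∈-upTo⁻ β∈)))
    ∷ block alloc cAlloc
    ∷ block (uncurry eqF) (λ p → let x∈ , y∈ = ∈-cartesianProduct⁻ X X p in cEq x∈ y∈)
    ∷ block (uncurry ptF) (λ p → let x∈ , y∈ = ∈-cartesianProduct⁻ X X p in cPt x∈ y∈)
    ∷ [])
    where
    block : ∀ {A : Set} (f : A → Form) {xs} → (∀ {a} → a ∈ xs → IsCore X m (f a)) →
            All (IsCore X m) (map f xs)
    block f core = All.map⁺ (tabulate core)

  coreList-unique : Distinct X → Unique (coreList X m)
  coreList-unique dX = Unique.concat⁺ {xss = coreBlocks X m}
    ( Unique.map⁺ sizeGe-injective (Unique.upTo⁺ (suc m))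
    ∷ Unique.map⁺ (λ { refl → refl }) uX
    ∷ Unique.map⁺ (λ { {_ , _} {_ , _} refl → refl }) (Unique.cartesianProduct⁺ uX uX)
    ∷ Unique.map⁺ (λ { {_ , _} {_ , _} refl → refl }) (Unique.cartesianProduct⁺ uX uX)
    ∷ [])
    ( ( images-disjoint {f = sizeGe} {xs = upTo (suc m)} sizeGe≢alloc
      ∷ images-disjoint {f = sizeGe} {xs = upTo (suc m)} (λ β (x , y) → sizeGe≢eqF β x y)
      ∷ images-disjoint {f = sizeGe} {xs = upTo (suc m)} (λ β (x , y) → sizeGe≢ptF β x y) ∷ [])
    ∷ (images-disjoint (λ _ _ ()) ∷ images-disjoint (λ _ _ ()) ∷ [])
    ∷ (images-disjoint (λ _ _ ()) ∷ [])
    ∷ [] ∷ [])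
    where
    uX : Unique X
    uX = distinct⇒unique dX

Signs : List Form → Set
Signs C = All (λ _ → Bool) C

signed : Bool → Form → Form
signed true φ = φ
signed false φ = neg φ

literals : ∀ {C} → Signs C → List Form
literals [] = []
literals {c ∷ _} (b ∷ s) = signed b c ∷ literals s

conjunction : ∀ {C} → Signs C → Form
conjunction s = bigAnd (literals s)

allSigns : (C : List Form) → List (Signs C)
allSigns [] = [ [] ]
allSigns (c ∷ C) = cartesianProductWith _∷_ (true ∷ false ∷ []) (allSigns C)

∈-allSigns : ∀ {C} (s : Signs C) → s ∈ allSigns C
∈-allSigns [] = here refl
∈-allSigns (b ∷ s) = ∈-cartesianProductWith⁺ _∷_ (bool∈ b) (∈-allSigns s)
  where
  bool∈ : ∀ b → b ∈ true ∷ false ∷ []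
  bool∈ true = here refl
  bool∈ false = there (here refl)

∈-literals⁺ : ∀ {C ψ} (s : Signs C) (p : ψ ∈ C) → signed (lookup s p) ψ ∈ literals s
∈-literals⁺ (b ∷ s) (here refl) = here refl
∈-literals⁺ (b ∷ s) (there p) = there (∈-literals⁺ s p)

∈-literals⁻ : ∀ {C χ} (s : Signs C) → χ ∈ literals s →
              ∃ λ c → Σ (c ∈ C) λ p → χ ≡ signed (lookup s p) c
∈-literals⁻ (b ∷ s) (here refl) = _ , here refl , refl
∈-literals⁻ (b ∷ s) (there q) = let c , p , χ≡ = ∈-literals⁻ s q in c , there p , χ≡

All-literals : ∀ {C} {P Q : Form → Set} → (∀ b {c} → P c → Q (signed b c)) →
               All P C → (s : Signs C) → All Q (literals s)
All-literals P⇒Q [] [] = []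
All-literals P⇒Q (pc ∷ pC) (b ∷ s) = P⇒Q b pc ∷ All-literals P⇒Q pC s

module Semantics {v : Form → Bool} (std : Standard v) where

  Agrees : ∀ {C} → Signs C → Set
  Agrees {C} s = ∀ {ψ} (p : ψ ∈ C) → lookup s p ≡ evalP v ψ

  signsOf : (C : List Form) → Signs C
  signsOf [] = []
  signsOf (c ∷ C) = evalP v c ∷ signsOf C

  signsOf-agrees : ∀ C → Agrees (signsOf C)
  signsOf-agrees (c ∷ C) (here refl) = refl
  signsOf-agrees (c ∷ C) (there p) = signsOf-agrees C p

  signed-holds : ∀ b {c} → T (evalP v (signed b c)) ⇔ b ≡ evalP v c
  signed-holds true = mk⇔ (sym ∘ to T-≡) (from T-≡ ∘ sym)
  signed-holds false = mk⇔ (sym ∘ to T-not-≡) (from T-not-≡ ∘ sym)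

  literals-hold : ∀ {C} (s : Signs C) → All (T ∘ evalP v) (literals s) ⇔ Agrees s
  literals-hold s = mk⇔ (holds⇒agrees s) (agrees⇒holds s)
    where
    holds⇒agrees : ∀ {C} (s : Signs C) → All (T ∘ evalP v) (literals s) → Agrees s
    holds⇒agrees (b ∷ s) (t ∷ ts) (here refl) = to (signed-holds b) t
    holds⇒agrees (b ∷ s) (t ∷ ts) (there p) = holds⇒agrees s ts p
    agrees⇒holds : ∀ {C} (s : Signs C) → Agrees s → All (T ∘ evalP v) (literals s)
    agrees⇒holds [] _ = []
    agrees⇒holds (b ∷ s) ag = from (signed-holds b) (ag (here refl)) ∷ agrees⇒holds s (ag ∘ there)

  conjunction-holds : ∀ {C} (s : Signs C) → T (evalP v (conjunction s)) ⇔ Agrees s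
  conjunction-holds s = ⇔-trans (bigAnd-holds std (literals s)) (literals-hold s)

module _ {X : List PVar} {m : ℕ} where

  signed-injective : ∀ {a b ψ χ} → IsCore X m ψ → IsCore X m χ →
                     signed a ψ ≡ signed b χ → a ≡ b × ψ ≡ χ
  signed-injective {true} {true} _ _ ψ≡χ = refl , ψ≡χ
  signed-injective {false} {false} _ _ refl = refl , refl
  signed-injective {true} {false} cψ cχ ψ≡¬χ = ⊥-elim (core≢neg-core cψ cχ ψ≡¬χ)
  signed-injective {false} {true} cψ cχ ¬ψ≡χ = ⊥-elim (core≢neg-core cχ cψ (sym ¬ψ≡χ))

  sign-determined : ∀ {C ψ} → Unique C → All (IsCore X m) C → (s : Signs C) (p : ψ ∈ C) →
                    ∀ {b} → signed b ψ ∈ literals s → lookup s p ≡ b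
  sign-determined u core s p q with ∈-literals⁻ s q
  ... | c , r , eq with signed-injective (lookup core p) (lookup core r) eq
  ...   | refl , refl = cong (lookup s) (unique⇒irrelevant u p r)

  ExactlyOne : Form → List Form → Set
  ExactlyOne ψ L = ((ψ ∈ L) × ¬ (neg ψ ∈ L)) ⊎ ((neg ψ ∈ L) × ¬ (ψ ∈ L))

  exactly-one : ∀ {C ψ} → Unique C → All (IsCore X m) C → (s : Signs C) → ψ ∈ C →
                ExactlyOne ψ (literals s)
  exactly-one u core s p with lookup s p | ∈-literals⁺ s p | sign-determined u core s p
  ... | true | occurs | determined = inj₁ (occurs , λ q → case determined {false} q of λ ())
  ... | false | occurs | determined = inj₂ (occurs , λ q → case determined {true} q of λ ())

  signed-atomic : ∀ b {c} → IsCore X m c → conjuncts (signed b c) ≡ [ signed b c ]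
  signed-atomic true c = core-conjuncts c
  signed-atomic false c = refl

  signed-literal : ∀ b {c} → IsCore X m c → IsLiteral X m (signed b c)
  signed-literal true c = pos c
  signed-literal false c = ngt c

  conjuncts-bigAnd : ∀ l L → All (λ φ → conjuncts φ ≡ [ φ ]) (l ∷ L) →
                     conjuncts (bigAnd (l ∷ L)) ≡ l ∷ L
  conjuncts-bigAnd l [] (atomic ∷ []) = atomic
  conjuncts-bigAnd l (l′ ∷ L) (atomic ∷ rest) =
    cong₂ _++_ atomic (conjuncts-bigAnd l′ L rest)

  -- C is nonempty because size≥0 is a core formula.
  conjunction-isType : ∀ {C} → Unique C → All (IsCore X m) C → (∀ {ψ} → IsCore X m ψ → ψ ∈ C) →
                       (s : Signs C) → IsType X m (conjunction s)
  conjunction-isType {[]} _ _ complete [] with complete (cSize z≤n)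
  ... | ()
  conjunction-isType {c ∷ C} u core complete (b ∷ s)
    rewrite conjuncts-bigAnd (signed b c) (literals s) (All-literals signed-atomic core (b ∷ s)) =
    All-literals signed-literal core (b ∷ s) , λ ψ cψ → exactly-one u core (b ∷ s) (complete cψ)

module TruthTable {X : List PVar} {α : ℕ} {C : List Form} (leaf : ∀ {ψ} → IsCore X α ψ → ψ ∈ C) where

  valueUnder : ∀ {φ} → Signs C → IsBoolComb X α φ → Bool
  valueUnder s = evalBC (λ c → lookup s (leaf c))

  selected : ∀ {φ} → IsBoolComb X α φ → List (Signs C)
  selected d = filter (λ s → T? (valueUnder s d)) (allSigns C)

  dnf : ∀ {φ} → IsBoolComb X α φ → List Form
  dnf d = map conjunction (selected d)

  dnf-equivalent : ∀ {φ} (d : IsBoolComb X α φ) → ⊢C iffF φ (bigOr (dnf d))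
  dnf-equivalent {φ} d = truth-table same-value
    where
    same-value : ∀ v → Standard v → evalP v φ ≡ evalP v (bigOr (dnf d))
    same-value v std = T-ext forward backward
      where
      open Semantics {v} std
      value-agrees : (s : Signs C) → Agrees s → valueUnder s d ≡ evalP v φ
      value-agrees s ag = evalBC-sound _ v (ag ∘ leaf) d
      -- If φ holds, the pattern read off from v is selected and its conjunction holds.
      forward : T (evalP v φ) → T (evalP v (bigOr (dnf d)))
      forward t = from (bigOr-holds std (dnf d))
        (Any.map⁺ (lose chosen (from (conjunction-holds (signsOf C)) (signsOf-agrees C))))
        where
        chosen : signsOf C ∈ selected d
        chosen = ∈-filter⁺ (λ s → T? (valueUnder s d)) (∈-allSigns (signsOf C))
          (subst T (sym (value-agrees (signsOf C) (signsOf-agrees C))) t)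
      -- A selected pattern whose conjunction holds agrees with v, so φ holds.
      backward : T (evalP v (bigOr (dnf d))) → T (evalP v φ)
      backward t with find (Any.map⁻ {f = conjunction} (to (bigOr-holds std (dnf d)) t))
      ... | s , s∈ , holds =
        subst T (value-agrees s (to (conjunction-holds s) holds))
          (proj₂ (∈-filter⁻ (λ s → T? (valueUnder s d)) {xs = allSigns C} s∈))

lemma4p2 : (X : List PVar) → Distinct X → (α : ℕ) → (φ : Form) → IsBoolComb X α φ →
    Σ (List Form) (λ ψs → All (IsType X (card X ⊔ α)) ψs × ⊢C (iffF φ (bigOr ψs)))
lemma4p2 X dX α φ d = dnf d , types , dnf-equivalent d
  where
  m : ℕ
  m = card X ⊔ α
  open TruthTable (coreList-complete X m ∘ core-mono (m≤n⊔m (card X) α))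
  types : All (IsType X m) (dnf d)
  types = All.map⁺ (tabulate λ {s} _ →
    conjunction-isType (coreList-unique X m dX) (coreList-sound X m) (coreList-complete X m) s)
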